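{- In $\mathbb{Z}[[s]]$ (limits taken coefficientwise), $$\lim_{n\to\infty}G^{(s)}_{n}(1,1,s)=\sum_{k\ge0}\frac{s^{k^2}}{\prod_{j=1}^{k}(1-s^j)},$$ and $$\lim_{n\rightarrow\infty}\frac{G^{(s)}_{n}(1,1,s)-G^{(c)}_{n}(1,1,s)}{s^{n+1}}=s^{ -1}\left(\sum_{k\ge0}\frac{s^{k^2}}{\prod_{j=1}^{k}(1-s^j)}-\sum_{k\ge0}\frac{s^{k(k+1)}}{\prod_{j=1}^{k}(1-s^j)}\right)=\sum_{k\ge0}\frac{s^{k(k+2)}}{\prod_{j=1}^{k}(1-s^j)}.$$
   Context: For a subset $S\subseteq\{1,\dots,n\}$ let $|S|$ be its size and $\sigma(S)=\sum_{i\in S}i$. Segment: with $c(S)$ the number of maximal runs of consecutive integers in $S$, $G_n^{(s)}(m,r,s)=\sum_{S} s^{\sigma(S)}r^{|S|}m^{c(S)}(m-1)^{|S|-c(S)}$. Circle: for $n\ge3$, regard positions cyclically ($n$ and $1$ adjacent) and set $G_n^{(c)}(m,r,s)=\sum_{S} s^{\sigma(S)}r^{|S|}P_S(m)$, where $P_S(m)=m^{c_o(S)}(m-1)^{|S|-c_o(S)}$ for $S\neq\{1,\dots,n\}$ ($c_o(S)$ = number of maximal cyclic runs in $S$) and $P_S(m)=(m-1)^n+(-1)^n(m-1)$ for $S=\{1,\dots,n\}$; for $n\le2$, $G_n^{(c)}:=G_n^{(s)}$. -}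

module Defs where

open import Data.Bool using (Bool; true; false; if_then_else_; _∧_; not)
open import Data.Nat as ℕ using (ℕ; zero; suc; _≡ᵇ_; _≤ᵇ_; _≤_; _<_)
open import Data.Integer using (ℤ; +_; _+_; _*_; _-_; -_; _^_; 0ℤ; 1ℤ)
open import Data.List using (List; []; _∷_; map; _++_; foldr)
open import Data.Product using (∃; _×_)
open import Relation.Binary.PropositionalEquality using (_≡_)

PS : Set
PS = ℕ → ℤ

sumℤ : List ℤ → ℤ
sumℤ = foldr _+_ 0ℤ

sumTo : ℕ → (ℕ → ℤ) → ℤ
sumTo zero    f = f 0
sumTo (suc d) f = sumTo d f + f (suc d)

_⊛_ : PS → PS → PS
(f ⊛ g) d = sumTo d (λ i → f i * g (d ℕ.∸ i))

onePS : PS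
onePS zero    = 1ℤ
onePS (suc _) = 0ℤ

mono : ℕ → PS
mono e d = if e ≡ᵇ d then 1ℤ else 0ℤ

-- 1/(1 - s^j) = Σ_{t≥0} s^{j t}, for j ≥ 1 (coefficient d: Σ_{t ≤ d} [j t = d])
geomInv : ℕ → PS
geomInv j d = sumTo d (λ t → mono (j ℕ.* t) d)

prodGeomInv : ℕ → PS
prodGeomInv zero    = onePS
prodGeomInv (suc k) = prodGeomInv k ⊛ geomInv (suc k)

-- Σ_{k≥0} s^{e k} / Π_{j=1}^{k}(1 - s^j), for an exponent function with e k ≥ k;
-- the k-th term has order e k ≥ k, so only k ≤ d contribute to coefficient d.
rrSeries : (ℕ → ℕ) → PS
rrSeries e d = sumTo d (λ k → (mono (e k) ⊛ prodGeomInv k) d)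

-- Subsets of {1,…,n} as Boolean lists b₁ … bₙ (bᵢ = true iff i ∈ S).
subsets : ℕ → List (List Bool)
subsets zero    = [] ∷ []
subsets (suc n) = map (false ∷_) (subsets n) ++ map (true ∷_) (subsets n)

σFrom : ℕ → List Bool → ℕ
σFrom i []       = 0
σFrom i (b ∷ bs) = (if b then i else 0) ℕ.+ σFrom (suc i) bs

σ : List Bool → ℕ
σ = σFrom 1

size : List Bool → ℕ
size []       = 0
size (b ∷ bs) = (if b then 1 else 0) ℕ.+ size bs

-- number of run starts, given whether the predecessor of the first position is in S
runsAux : Bool → List Bool → ℕ
runsAux prev []       = 0
runsAux prev (b ∷ bs) = (if b ∧ not prev then 1 else 0) ℕ.+ runsAux b bs

runs : List Bool → ℕ
runs = runsAux false

lastB : List Bool → Bool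
lastB []           = false
lastB (b ∷ [])     = b
lastB (_ ∷ b ∷ bs) = lastB (b ∷ bs)

-- c_o(S): number of maximal cyclic runs (valid for S ≠ full set)
cycRuns : List Bool → ℕ
cycRuns S = runsAux (lastB S) S

isFull : List Bool → Bool
isFull []       = true
isFull (b ∷ bs) = b ∧ isFull bs

segWeight : ℤ → ℤ → List Bool → ℤ
segWeight m r S = (r ^ size S) * ((m ^ runs S) * ((m - 1ℤ) ^ (size S ℕ.∸ runs S)))

Gseg : ℤ → ℤ → ℕ → PS
Gseg m r n d = sumℤ (map (λ S → if σ S ≡ᵇ d then segWeight m r S else 0ℤ) (subsets n))

Pcyc : ℕ → ℤ → List Bool → ℤ
Pcyc n m S =
  if isFull S
  then ((m - 1ℤ) ^ n) + (((- 1ℤ) ^ n) * (m - 1ℤ))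
  else (m ^ cycRuns S) * ((m - 1ℤ) ^ (size S ℕ.∸ cycRuns S))

Gcyc : ℤ → ℤ → ℕ → PS
Gcyc m r n d =
  if n ≤ᵇ 2
  then Gseg m r n d
  else sumℤ (map (λ S → if σ S ≡ᵇ d then (r ^ size S) * Pcyc n m S else 0ℤ) (subsets n))

ConvergesTo : (ℕ → PS) → PS → Set
ConvergesTo f g = ∀ d → ∃ λ N → ∀ n → N ≤ n → f n d ≡ g d

-- (G^{(s)}_n(1,1,s) - G^{(c)}_n(1,1,s)) / s^{n+1}, given divisibility (see statement)
diffQuot : ℕ → PS
diffQuot n d = Gseg 1ℤ 1ℤ n (d ℕ.+ suc n) - Gcyc 1ℤ 1ℤ n (d ℕ.+ suc n)

seriesA seriesB seriesC : PS
seriesA = rrSeries (λ k → k ℕ.* k)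
seriesB = rrSeries (λ k → k ℕ.* suc k)
seriesC = rrSeries (λ k → k ℕ.* suc (suc k))

-- At m = r = 1 the factor 0 ^ (|S| - c(S)) keeps exactly the subsets of {1,…,n} with no
-- two consecutive elements, so G^(s)_n(1,1,s) sums s^σ(S) over these, and G^(c)_n(1,1,s)
-- over the cyclically independent sets (the full circle contributing 0). Deciding
-- whether the first position j+1 is occupied shows that the independent subsets of
-- {j+1,…,j+n} satisfy F = F' + s^(j+1) F'', the same functional equation
-- F_j = F_{j+1} + s^(j+1) F_{j+2} as F_j = Σ_k s^(k(k+j)) / (s;s)_k, which in turn
-- follows from 1/(s;s)_{k+1} = 1/(s;s)_k + s^(k+1)/(s;s)_{k+1}. Hence both agree below
-- s^(j+n+1), and A = F_0 is the limit. The segment and circle sums differ by the sets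
-- containing both 1 and n, i.e. by s^(n+1) times the independent subsets of {3,…,n-2};
-- so the quotient tends to F_2 = C, while the equation for j = 0 gives A - B = s F_2.

module Submission where

open import Defs
open import Data.Bool using (Bool; true; false; if_then_else_; _∧_)
open import Data.Bool.Properties using (if-∧; if-eta)
open import Data.Integer using (ℤ; _+_; _*_; _-_; -_; _^_; 0ℤ; 1ℤ)
import Data.Integer.Properties as ℤₚ
open import Data.List using (List; []; _∷_; map; _++_)
import Data.List.Properties as Listₚ
open import Data.Nat as ℕ using (ℕ; zero; suc; _≡ᵇ_; _≤ᵇ_; _∸_; _≤_; _<_; z≤n; s≤s)
import Data.Nat.Properties as ℕₚ
open import Data.Nat.Tactic.RingSolver using (solve-∀)
open import Data.Product using (_×_; _,_)
open import Data.Sum using (inj₁; inj₂)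
open import Function using (_∘_)
open import Relation.Binary.PropositionalEquality
open ≡-Reasoning

open import Algebra.Properties.AbelianGroup ℤₚ.+-0-abelianGroup using (xyx⁻¹≈y)
open import Algebra.Properties.CommutativeSemigroup ℤₚ.+-commutativeSemigroup using (interchange)

≤ᵇ-suc : ∀ m n → (suc m ≤ᵇ suc n) ≡ (m ≤ᵇ n)
≤ᵇ-suc zero    n = refl
≤ᵇ-suc (suc m) n = refl

≤⇒≤ᵇ≡true : ∀ {m n} → m ≤ n → (m ≤ᵇ n) ≡ true
≤⇒≤ᵇ≡true z≤n               = refl
≤⇒≤ᵇ≡true (s≤s {m} {n} m≤n) = trans (≤ᵇ-suc m n) (≤⇒≤ᵇ≡true m≤n)

>⇒≤ᵇ≡false : ∀ {m n} → n < m → (m ≤ᵇ n) ≡ false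
>⇒≤ᵇ≡false {suc m} {zero}  _         = refl
>⇒≤ᵇ≡false {suc m} {suc n} (s≤s n<m) = trans (≤ᵇ-suc m n) (>⇒≤ᵇ≡false n<m)

>⇒≡ᵇ≡false : ∀ {m n} → n < m → (m ≡ᵇ n) ≡ false
>⇒≡ᵇ≡false {suc m} {zero}  _         = refl
>⇒≡ᵇ≡false {suc m} {suc n} (s≤s n<m) = >⇒≡ᵇ≡false n<m

≤ᵇ-+ : ∀ m n d → (m ℕ.+ n ≤ᵇ d) ≡ ((m ≤ᵇ d) ∧ (n ≤ᵇ d ∸ m))
≤ᵇ-+ zero    n d       = refl
≤ᵇ-+ (suc m) n zero    = refl
≤ᵇ-+ (suc m) n (suc d) = begin
  suc m ℕ.+ n ≤ᵇ suc d               ≡⟨ ≤ᵇ-suc (m ℕ.+ n) d ⟩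
  m ℕ.+ n ≤ᵇ d                       ≡⟨ ≤ᵇ-+ m n d ⟩
  (m ≤ᵇ d) ∧ (n ≤ᵇ d ∸ m)            ≡⟨ cong (_∧ (n ≤ᵇ d ∸ m)) (≤ᵇ-suc m d) ⟨
  (suc m ≤ᵇ suc d) ∧ (n ≤ᵇ d ∸ m)    ∎

≡ᵇ-+ : ∀ m n d → (m ℕ.+ n ≡ᵇ d) ≡ ((m ≤ᵇ d) ∧ (n ≡ᵇ d ∸ m))
≡ᵇ-+ zero    n d       = refl
≡ᵇ-+ (suc m) n zero    = refl
≡ᵇ-+ (suc m) n (suc d) = trans (≡ᵇ-+ m n d) (cong (_∧ (n ≡ᵇ d ∸ m)) (sym (≤ᵇ-suc m d)))

0^suc≡0 : ∀ n → 0ℤ ^ suc n ≡ 0ℤ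
0^suc≡0 n = ℤₚ.*-zeroˡ (0ℤ ^ n)

sumTo-cong : ∀ d {f g : ℕ → ℤ} → (∀ i → i ≤ d → f i ≡ g i) → sumTo d f ≡ sumTo d g
sumTo-cong zero    eq = eq 0 z≤n
sumTo-cong (suc d) eq =
  cong₂ _+_ (sumTo-cong d (λ i i≤d → eq i (ℕₚ.m≤n⇒m≤1+n i≤d))) (eq (suc d) ℕₚ.≤-refl)

sumTo-zero : ∀ d {f : ℕ → ℤ} → (∀ i → i ≤ d → f i ≡ 0ℤ) → sumTo d f ≡ 0ℤ
sumTo-zero zero    eq = eq 0 z≤n
sumTo-zero (suc d) eq =
  cong₂ _+_ (sumTo-zero d (λ i i≤d → eq i (ℕₚ.m≤n⇒m≤1+n i≤d))) (eq (suc d) ℕₚ.≤-refl)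

sumTo-unfoldˡ : ∀ d (f : ℕ → ℤ) → sumTo (suc d) f ≡ f 0 + sumTo d (f ∘ suc)
sumTo-unfoldˡ zero    f = refl
sumTo-unfoldˡ (suc d) f =
  trans (cong (_+ f (2 ℕ.+ d)) (sumTo-unfoldˡ d f)) (ℤₚ.+-assoc (f 0) _ _)

sumTo-distrib-+ : ∀ d (f g : ℕ → ℤ) → sumTo d (λ i → f i + g i) ≡ sumTo d f + sumTo d g
sumTo-distrib-+ zero    f g = refl
sumTo-distrib-+ (suc d) f g =
  trans (cong (_+ (f (suc d) + g (suc d))) (sumTo-distrib-+ d f g))
        (interchange (sumTo d f) (sumTo d g) (f (suc d)) (g (suc d)))

sumTo-truncate : ∀ {b} m {f : ℕ → ℤ} → b ≤ m → (∀ i → b < i → i ≤ m → f i ≡ 0ℤ) →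
                 sumTo m f ≡ sumTo b f
sumTo-truncate zero    z≤n _ = refl
sumTo-truncate (suc m) b≤1+m vanish with ℕₚ.m≤n⇒m<n∨m≡n b≤1+m
... | inj₂ refl      = refl
... | inj₁ (s≤s b≤m) =
  trans (cong₂ _+_ (sumTo-truncate m b≤m (λ i b<i i≤m → vanish i b<i (ℕₚ.m≤n⇒m≤1+n i≤m)))
                   (vanish (suc m) (s≤s b≤m) ℕₚ.≤-refl))
        (ℤₚ.+-identityʳ _)

sumTo-indicator : ∀ d e (g : ℕ → ℤ) →
                  sumTo d (λ i → if e ≡ᵇ i then g i else 0ℤ) ≡ (if e ≤ᵇ d then g e else 0ℤ)
sumTo-indicator zero    zero    g = refl
sumTo-indicator zero    (suc e) g = refl
sumTo-indicator (suc d) zero    g =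
  trans (sumTo-unfoldˡ d _) (trans (cong (g 0 +_) (sumTo-zero d (λ _ _ → refl))) (ℤₚ.+-identityʳ _))
sumTo-indicator (suc d) (suc e) g =
  trans (sumTo-unfoldˡ d _)
        (trans (ℤₚ.+-identityˡ _)
        (trans (sumTo-indicator d e (g ∘ suc)) (cong (if_then g (suc e) else 0ℤ) (sym (≤ᵇ-suc e d)))))

-- Coefficients of s ^ e · f.
shift : ℕ → PS → PS
shift e f d = if e ≤ᵇ d then f (d ∸ e) else 0ℤ

shift-cong : ∀ e {f g : PS} → (∀ x → f x ≡ g x) → ∀ d → shift e f d ≡ shift e g d
shift-cong e eq d = cong (if e ≤ᵇ d then_else 0ℤ) (eq (d ∸ e))

shift-vanish : ∀ e {f : PS} → (∀ x → f x ≡ 0ℤ) → ∀ d → shift e f d ≡ 0ℤ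
shift-vanish e eq d = trans (shift-cong e eq d) (if-eta (e ≤ᵇ d))

shift-below : ∀ {e d} (f : PS) → d < e → shift e f d ≡ 0ℤ
shift-below {e} {d} f d<e = cong (if_then f (d ∸ e) else 0ℤ) (>⇒≤ᵇ≡false d<e)

shift-apply : ∀ e (f : PS) d → shift e f (d ℕ.+ e) ≡ f d
shift-apply e f d =
  cong₂ (if_then_else 0ℤ) (≤⇒≤ᵇ≡true (ℕₚ.m≤n+m e d)) (cong f (ℕₚ.m+n∸n≡m d e))

shift-distrib-+ : ∀ e (f g : PS) d → shift e (λ x → f x + g x) d ≡ shift e f d + shift e g d
shift-distrib-+ e f g d with e ≤ᵇ d
... | true  = refl
... | false = refl

shift-shift : ∀ v w (f : PS) d → shift v (shift w f) d ≡ shift (v ℕ.+ w) f d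
shift-shift v w f d = begin
  (if v ≤ᵇ d then (if w ≤ᵇ d ∸ v then f (d ∸ v ∸ w) else 0ℤ) else 0ℤ)
    ≡⟨ if-∧ (v ≤ᵇ d) ⟨
  (if (v ≤ᵇ d) ∧ (w ≤ᵇ d ∸ v) then f (d ∸ v ∸ w) else 0ℤ)
    ≡⟨ cong₂ (if_then_else 0ℤ) (sym (≤ᵇ-+ v w d)) (cong f (ℕₚ.∸-+-assoc d v w)) ⟩
  (if v ℕ.+ w ≤ᵇ d then f (d ∸ (v ℕ.+ w)) else 0ℤ) ∎

shift-comm : ∀ v w (f : PS) d → shift v (shift w f) d ≡ shift w (shift v f) d
shift-comm v w f d = begin
  shift v (shift w f) d  ≡⟨ shift-shift v w f d ⟩
  shift (v ℕ.+ w) f d    ≡⟨ cong (λ e → shift e f d) (ℕₚ.+-comm v w) ⟩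
  shift (w ℕ.+ v) f d    ≡⟨ shift-shift w v f d ⟨
  shift w (shift v f) d  ∎

sumTo-shift : ∀ n e (g : ℕ → PS) d →
              sumTo n (λ t → shift e (g t) d) ≡ shift e (λ x → sumTo n (λ t → g t x)) d
sumTo-shift n e g d with e ≤ᵇ d
... | true  = refl
... | false = sumTo-zero n (λ _ _ → refl)

mono-⊛ : ∀ e (f : PS) d → (mono e ⊛ f) d ≡ shift e f d
mono-⊛ e f d =
  trans (sumTo-cong d (λ i _ → indicator*y (e ≡ᵇ i) (f (d ∸ i)))) (sumTo-indicator d e (λ i → f (d ∸ i)))
  where
  indicator*y : ∀ c y → (if c then 1ℤ else 0ℤ) * y ≡ (if c then y else 0ℤ)
  indicator*y true  y = ℤₚ.*-identityˡ y
  indicator*y false y = refl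

mono-+ : ∀ m n d → mono (m ℕ.+ n) d ≡ shift m (mono n) d
mono-+ m n d = trans (cong (if_then 1ℤ else 0ℤ) (≡ᵇ-+ m n d)) (if-∧ (m ≤ᵇ d))

mono-below : ∀ {e d} → d < e → mono e d ≡ 0ℤ
mono-below d<e = cong (if_then 1ℤ else 0ℤ) (>⇒≡ᵇ≡false d<e)

⊛-congʳ : ∀ (f : PS) {g h : PS} → (∀ x → g x ≡ h x) → ∀ d → (f ⊛ g) d ≡ (f ⊛ h) d
⊛-congʳ f eq d = sumTo-cong d (λ i _ → cong (f i *_) (eq (d ∸ i)))

⊛-distribˡ-+ : ∀ (f g h : PS) d → (f ⊛ (λ x → g x + h x)) d ≡ (f ⊛ g) d + (f ⊛ h) d
⊛-distribˡ-+ f g h d =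
  trans (sumTo-cong d (λ i _ → ℤₚ.*-distribˡ-+ (f i) (g (d ∸ i)) (h (d ∸ i))))
        (sumTo-distrib-+ d _ _)

⊛-identityʳ : ∀ (f : PS) d → (f ⊛ onePS) d ≡ f d
⊛-identityʳ f zero    = ℤₚ.*-identityʳ (f 0)
⊛-identityʳ f (suc d) = begin
  sumTo d (λ i → f i * onePS (suc d ∸ i)) + f (suc d) * onePS (d ∸ d)
    ≡⟨ cong₂ _+_ (sumTo-zero d (λ i i≤d → trans (cong (λ x → f i * onePS x) (ℕₚ.+-∸-assoc 1 i≤d))
                                                 (ℤₚ.*-zeroʳ (f i))))
                 (trans (cong (λ x → f (suc d) * onePS x) (ℕₚ.n∸n≡0 d)) (ℤₚ.*-identityʳ (f (suc d)))) ⟩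
  0ℤ + f (suc d)
    ≡⟨ ℤₚ.+-identityˡ (f (suc d)) ⟩
  f (suc d) ∎

⊛-shift1ʳ : ∀ (f g : PS) d → (f ⊛ shift 1 g) d ≡ shift 1 (f ⊛ g) d
⊛-shift1ʳ f g zero    = ℤₚ.*-zeroʳ (f 0)
⊛-shift1ʳ f g (suc d) = begin
  sumTo d (λ i → f i * shift 1 g (suc d ∸ i)) + f (suc d) * shift 1 g (d ∸ d)
    ≡⟨ cong₂ _+_ (sumTo-cong d (λ i i≤d → cong (λ x → f i * shift 1 g x) (ℕₚ.+-∸-assoc 1 i≤d)))
                 (trans (cong (λ x → f (suc d) * shift 1 g x) (ℕₚ.n∸n≡0 d)) (ℤₚ.*-zeroʳ (f (suc d)))) ⟩
  (f ⊛ g) d + 0ℤ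
    ≡⟨ ℤₚ.+-identityʳ _ ⟩
  (f ⊛ g) d ∎

⊛-shiftʳ : ∀ e (f g : PS) d → (f ⊛ shift e g) d ≡ shift e (f ⊛ g) d
⊛-shiftʳ zero    f g d = ⊛-congʳ f {shift 0 g} {g} (λ x → refl) d
⊛-shiftʳ (suc e) f g d = begin
  (f ⊛ shift (suc e) g) d      ≡⟨ ⊛-congʳ f (λ x → sym (shift-shift 1 e g x)) d ⟩
  (f ⊛ shift 1 (shift e g)) d  ≡⟨ ⊛-shift1ʳ f (shift e g) d ⟩
  shift 1 (f ⊛ shift e g) d    ≡⟨ shift-cong 1 (⊛-shiftʳ e f g) d ⟩
  shift 1 (shift e (f ⊛ g)) d  ≡⟨ shift-shift 1 e (f ⊛ g) d ⟩
  shift (suc e) (f ⊛ g) d      ∎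

geomInv-suc : ∀ k d → geomInv (suc k) d ≡ onePS d + shift (suc k) (geomInv (suc k)) d
geomInv-suc k zero    = cong (λ e → mono e 0) (ℕₚ.*-zeroʳ (suc k))
geomInv-suc k (suc d) = begin
  geomInv K (suc d)
    ≡⟨ sumTo-unfoldˡ d (λ t → mono (K ℕ.* t) (suc d)) ⟩
  mono (K ℕ.* 0) (suc d) + sumTo d (λ t → mono (K ℕ.* suc t) (suc d))
    ≡⟨ cong₂ _+_ (cong (λ e → mono e (suc d)) (ℕₚ.*-zeroʳ K)) (sumTo-cong d (λ t _ → step t)) ⟩
  0ℤ + sumTo d (λ t → shift K (mono (K ℕ.* t)) (suc d))
    ≡⟨ cong (0ℤ +_) (sumTo-shift d K (λ t → mono (K ℕ.* t)) (suc d)) ⟩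
  0ℤ + shift K (λ x → sumTo d (λ t → mono (K ℕ.* t) x)) (suc d)
    ≡⟨ cong (λ y → 0ℤ + (if K ≤ᵇ suc d then y else 0ℤ)) truncate ⟩
  0ℤ + shift K (geomInv K) (suc d) ∎
  where
  K = suc k
  r = d ∸ k
  step : ∀ t → mono (K ℕ.* suc t) (suc d) ≡ shift K (mono (K ℕ.* t)) (suc d)
  step t = trans (cong (λ e → mono e (suc d)) (ℕₚ.*-suc K t)) (mono-+ K (K ℕ.* t) (suc d))
  truncate : sumTo d (λ t → mono (K ℕ.* t) r) ≡ geomInv K r
  truncate = sumTo-truncate d (ℕₚ.m∸n≤m d k)
    (λ t r<t _ → mono-below (ℕₚ.<-≤-trans r<t (ℕₚ.m≤n*m t K)))

prodGeomInv-suc : ∀ k d →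
  prodGeomInv (suc k) d ≡ prodGeomInv k d + shift (suc k) (prodGeomInv (suc k)) d
prodGeomInv-suc k d = begin
  (P ⊛ geomInv K) d
    ≡⟨ ⊛-congʳ P (geomInv-suc k) d ⟩
  (P ⊛ (λ x → onePS x + shift K (geomInv K) x)) d
    ≡⟨ ⊛-distribˡ-+ P onePS (shift K (geomInv K)) d ⟩
  (P ⊛ onePS) d + (P ⊛ shift K (geomInv K)) d
    ≡⟨ cong₂ _+_ (⊛-identityʳ P d) (⊛-shiftʳ K P (geomInv K) d) ⟩
  P d + shift K (P ⊛ geomInv K) d ∎
  where
  K = suc k
  P = prodGeomInv k

-- The Rogers–Ramanujan family

rrSeries-cong : ∀ {e e′ : ℕ → ℕ} → (∀ k → e k ≡ e′ k) → ∀ d → rrSeries e d ≡ rrSeries e′ d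
rrSeries-cong eq d = sumTo-cong d (λ k _ → cong (λ x → (mono x ⊛ prodGeomInv k) d) (eq k))

rrTerm : ℕ → ℕ → PS
rrTerm j k = mono (k ℕ.* (k ℕ.+ j)) ⊛ prodGeomInv k

rrFamily : ℕ → PS
rrFamily j = rrSeries (λ k → k ℕ.* (k ℕ.+ j))

rrTerm-vanish : ∀ j k {d} → d < k ℕ.* (k ℕ.+ j) → rrTerm j k d ≡ 0ℤ
rrTerm-vanish j k {d} d<e =
  trans (mono-⊛ (k ℕ.* (k ℕ.+ j)) (prodGeomInv k) d) (shift-below (prodGeomInv k) d<e)

rrFamily-extend : ∀ j {D d} → d ≤ D → sumTo D (λ k → rrTerm j k d) ≡ rrFamily j d
rrFamily-extend j d≤D = sumTo-truncate _ d≤D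
  (λ { (suc k) d<k _ → rrTerm-vanish j (suc k) (ℕₚ.<-≤-trans d<k (ℕₚ.m≤m*n (suc k) (suc k ℕ.+ j))) })

rrTerm-suc : ∀ j k d →
  rrTerm j (suc k) d ≡ rrTerm (suc j) (suc k) d + shift (suc j) (rrTerm (suc (suc j)) k) d
rrTerm-suc j k d = begin
  rrTerm j K d
    ≡⟨ mono-⊛ (K ℕ.* (K ℕ.+ j)) P′ d ⟩
  shift (K ℕ.* (K ℕ.+ j)) P′ d
    ≡⟨ cong (λ e → shift e P′ d) (exponent₁ j k) ⟩
  shift (v ℕ.+ w) P′ d
    ≡⟨ shift-cong (v ℕ.+ w) (prodGeomInv-suc k) d ⟩
  shift (v ℕ.+ w) (λ x → P x + shift K P′ x) d
    ≡⟨ shift-distrib-+ (v ℕ.+ w) P (shift K P′) d ⟩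
  shift (v ℕ.+ w) P d + shift (v ℕ.+ w) (shift K P′) d
    ≡⟨ cong₂ _+_ (sym (shift-shift v w P d)) (shift-shift (v ℕ.+ w) K P′ d) ⟩
  shift v (shift w P) d + shift (v ℕ.+ w ℕ.+ K) P′ d
    ≡⟨ ℤₚ.+-comm (shift v (shift w P) d) (shift (v ℕ.+ w ℕ.+ K) P′ d) ⟩
  shift (v ℕ.+ w ℕ.+ K) P′ d + shift v (shift w P) d
    ≡⟨ cong₂ _+_ (trans (cong (λ e → shift e P′ d) (sym (exponent₂ j k)))
                        (sym (mono-⊛ (K ℕ.* (K ℕ.+ suc j)) P′ d)))
                 (shift-cong v (λ x → sym (mono-⊛ w P x)) d) ⟩
  rrTerm (suc j) K d + shift v (rrTerm (suc (suc j)) k) d ∎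
  where
  K = suc k
  v = suc j
  w = k ℕ.* (k ℕ.+ suc (suc j))
  P = prodGeomInv k
  P′ = prodGeomInv K
  exponent₁ : ∀ j k → suc k ℕ.* (suc k ℕ.+ j) ≡ suc j ℕ.+ k ℕ.* (k ℕ.+ suc (suc j))
  exponent₁ = solve-∀
  exponent₂ : ∀ j k → suc k ℕ.* (suc k ℕ.+ suc j) ≡ suc j ℕ.+ k ℕ.* (k ℕ.+ suc (suc j)) ℕ.+ suc k
  exponent₂ = solve-∀

rrFamily-rec : ∀ j d → rrFamily j d ≡ rrFamily (suc j) d + shift (suc j) (rrFamily (suc (suc j))) d
rrFamily-rec j zero    = refl
rrFamily-rec j (suc d) = begin
  rrFamily j D
    ≡⟨ sumTo-unfoldˡ d (λ k → rrTerm j k D) ⟩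
  rrTerm j 0 D + sumTo d (λ k → rrTerm j (suc k) D)
    ≡⟨ cong (rrTerm j 0 D +_) (trans (sumTo-cong d (λ k _ → rrTerm-suc j k D)) (sumTo-distrib-+ d T U)) ⟩
  rrTerm j 0 D + (sumTo d T + sumTo d U)
    ≡⟨ ℤₚ.+-assoc (rrTerm (suc j) 0 D) (sumTo d T) (sumTo d U) ⟨
  (rrTerm (suc j) 0 D + sumTo d T) + sumTo d U
    ≡⟨ cong (_+ sumTo d U) (sumTo-unfoldˡ d (λ k → rrTerm (suc j) k D)) ⟨
  rrFamily (suc j) D + sumTo d U
    ≡⟨ cong (rrFamily (suc j) D +_) (sumTo-shift d (suc j) (rrTerm (suc (suc j))) D) ⟩
  rrFamily (suc j) D + shift (suc j) (λ x → sumTo d (λ k → rrTerm (suc (suc j)) k x)) D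
    ≡⟨ cong (λ y → rrFamily (suc j) D + (if suc j ≤ᵇ D then y else 0ℤ))
            (rrFamily-extend (suc (suc j)) (ℕₚ.m∸n≤m d j)) ⟩
  rrFamily (suc j) D + shift (suc j) (rrFamily (suc (suc j))) D ∎
  where
  D = suc d
  T U : ℕ → ℤ
  T k = rrTerm (suc j) (suc k) D
  U k = shift (suc j) (rrTerm (suc (suc j)) k) D

rrFamily-small : ∀ j d → d ≤ j → rrFamily j d ≡ mono 0 d
rrFamily-small j zero    _       = refl
rrFamily-small j (suc d) 1+d≤j =
  trans (sumTo-unfoldˡ d (λ k → rrTerm j k (suc d)))
        (trans (cong₂ _+_ (mono-⊛ 0 onePS (suc d)) (sumTo-zero d (λ k _ → rrTerm-vanish j (suc k) (bound k))))
               (ℤₚ.+-identityʳ 0ℤ))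
  where
  bound : ∀ k → suc d < suc k ℕ.* (suc k ℕ.+ j)
  bound k = ℕₚ.≤-trans (s≤s 1+d≤j) (ℕₚ.≤-trans (s≤s (ℕₚ.m≤n+m j k)) (ℕₚ.m≤n*m (suc k ℕ.+ j) (suc k)))

sumℤ-++ : ∀ xs ys → sumℤ (xs ++ ys) ≡ sumℤ xs + sumℤ ys
sumℤ-++ []       ys = sym (ℤₚ.+-identityˡ (sumℤ ys))
sumℤ-++ (x ∷ xs) ys = trans (cong (x +_) (sumℤ-++ xs ys)) (sym (ℤₚ.+-assoc x (sumℤ xs) (sumℤ ys)))

sumℤ-map-vanish : ∀ {A : Set} {f : A → ℤ} → (∀ x → f x ≡ 0ℤ) → ∀ xs → sumℤ (map f xs) ≡ 0ℤ
sumℤ-map-vanish eq []       = refl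
sumℤ-map-vanish eq (x ∷ xs) = cong₂ _+_ (eq x) (sumℤ-map-vanish eq xs)

sumℤ-map-− : ∀ {A : Set} (f g : A → ℤ) xs →
             sumℤ (map f xs) - sumℤ (map g xs) ≡ sumℤ (map (λ x → f x - g x) xs)
sumℤ-map-− f g []       = refl
sumℤ-map-− f g (x ∷ xs) = begin
  (f x + sumℤ (map f xs)) - (g x + sumℤ (map g xs))
    ≡⟨ cong ((f x + sumℤ (map f xs)) +_) (ℤₚ.neg-distrib-+ (g x) (sumℤ (map g xs))) ⟩
  (f x + sumℤ (map f xs)) + (- g x + - sumℤ (map g xs))
    ≡⟨ interchange (f x) (sumℤ (map f xs)) (- g x) (- sumℤ (map g xs)) ⟩
  (f x - g x) + (sumℤ (map f xs) - sumℤ (map g xs))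
    ≡⟨ cong ((f x - g x) +_) (sumℤ-map-− f g xs) ⟩
  (f x - g x) + sumℤ (map (λ x → f x - g x) xs) ∎

sumℤ-map-if : ∀ {A : Set} c (f : A → ℤ) xs →
              sumℤ (map (λ x → if c then f x else 0ℤ) xs) ≡ (if c then sumℤ (map f xs) else 0ℤ)
sumℤ-map-if true  f xs = refl
sumℤ-map-if false f xs = sumℤ-map-vanish (λ _ → refl) xs

-- Σ_{S ⊆ {i, …, i + n - 1}} w(S) s^σ(S), the list entries standing for i, i + 1, …
subsetSeries : ℕ → ℕ → (List Bool → ℤ) → PS
subsetSeries i n w d = sumℤ (map (λ S → if σFrom i S ≡ᵇ d then w S else 0ℤ) (subsets n))

subsetSeries-cong : ∀ i n {w w′ : List Bool → ℤ} → (∀ S → w S ≡ w′ S) → ∀ d →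
                    subsetSeries i n w d ≡ subsetSeries i n w′ d
subsetSeries-cong i n eq d =
  cong sumℤ (Listₚ.map-cong (λ S → cong (if σFrom i S ≡ᵇ d then_else 0ℤ) (eq S)) (subsets n))

subsetSeries-vanish : ∀ i n {w : List Bool → ℤ} → (∀ S → w S ≡ 0ℤ) → ∀ d → subsetSeries i n w d ≡ 0ℤ
subsetSeries-vanish i n eq d = trans (subsetSeries-cong i n eq d)
  (sumℤ-map-vanish (λ S → if-eta (σFrom i S ≡ᵇ d)) (subsets n))

subsetSeries-− : ∀ i n (w w′ : List Bool → ℤ) d →
  subsetSeries i n w d - subsetSeries i n w′ d ≡ subsetSeries i n (λ S → w S - w′ S) d
subsetSeries-− i n w w′ d = trans (sumℤ-map-− _ _ (subsets n))
  (cong sumℤ (Listₚ.map-cong (λ S → if-− (σFrom i S ≡ᵇ d) (w S) (w′ S)) (subsets n)))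
  where
  if-− : ∀ c x y → (if c then x else 0ℤ) - (if c then y else 0ℤ) ≡ (if c then x - y else 0ℤ)
  if-− true  x y = refl
  if-− false x y = refl

subsetSeries-empty : ∀ i w d → subsetSeries i 0 w d ≡ (if 0 ≡ᵇ d then w [] else 0ℤ)
subsetSeries-empty i w d = ℤₚ.+-identityʳ _

subsetSeries-suc : ∀ i n w d → subsetSeries i (suc n) w d ≡
  subsetSeries (suc i) n (w ∘ (false ∷_)) d + shift i (subsetSeries (suc i) n (w ∘ (true ∷_))) d
subsetSeries-suc i n w d = begin
  sumℤ (map F (map (false ∷_) L ++ map (true ∷_) L))
    ≡⟨ cong sumℤ (Listₚ.map-++ F (map (false ∷_) L) (map (true ∷_) L)) ⟩
  sumℤ (map F (map (false ∷_) L) ++ map F (map (true ∷_) L))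
    ≡⟨ sumℤ-++ (map F (map (false ∷_) L)) (map F (map (true ∷_) L)) ⟩
  sumℤ (map F (map (false ∷_) L)) + sumℤ (map F (map (true ∷_) L))
    ≡⟨ cong₂ _+_ (cong sumℤ (sym (Listₚ.map-∘ L))) (cong sumℤ (sym (Listₚ.map-∘ L))) ⟩
  sumℤ (map (F ∘ (false ∷_)) L) + sumℤ (map (F ∘ (true ∷_)) L)
    ≡⟨ cong (sumℤ (map (F ∘ (false ∷_)) L) +_)
            (trans (cong sumℤ (Listₚ.map-cong split L)) (sumℤ-map-if (i ≤ᵇ d) _ L)) ⟩
  sumℤ (map (F ∘ (false ∷_)) L) + shift i (subsetSeries (suc i) n (w ∘ (true ∷_))) d ∎
  where
  L = subsets n
  F = λ S → if σFrom i S ≡ᵇ d then w S else 0ℤ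
  split : ∀ S → F (true ∷ S) ≡ (if i ≤ᵇ d then (if σFrom (suc i) S ≡ᵇ d ∸ i then w (true ∷ S) else 0ℤ) else 0ℤ)
  split S = trans (cong (if_then w (true ∷ S) else 0ℤ) (≡ᵇ-+ i (σFrom (suc i) S) d)) (if-∧ (i ≤ᵇ d))

subsetSeries-cong-∷ : ∀ i n {w w′ : List Bool → ℤ} → (∀ b S → w (b ∷ S) ≡ w′ (b ∷ S)) → ∀ d →
                      subsetSeries i (suc n) w d ≡ subsetSeries i (suc n) w′ d
subsetSeries-cong-∷ i n {w} {w′} eq d = begin
  subsetSeries i (suc n) w d
    ≡⟨ subsetSeries-suc i n w d ⟩
  subsetSeries (suc i) n (w ∘ (false ∷_)) d + shift i (subsetSeries (suc i) n (w ∘ (true ∷_))) d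
    ≡⟨ cong₂ _+_ (subsetSeries-cong (suc i) n (eq false) d)
                 (shift-cong i (subsetSeries-cong (suc i) n (eq true)) d) ⟩
  subsetSeries (suc i) n (w′ ∘ (false ∷_)) d + shift i (subsetSeries (suc i) n (w′ ∘ (true ∷_))) d
    ≡⟨ subsetSeries-suc i n w′ d ⟨
  subsetSeries i (suc n) w′ d ∎

-- Independent sets on the segment and on the circle

-- Number of pairs of consecutive elements of S, where `p` says whether the position
-- just before the first one belongs to S.
adjacencies : Bool → List Bool → ℕ
adjacencies p []       = 0
adjacencies p (b ∷ bs) = (if b ∧ p then 1 else 0) ℕ.+ adjacencies b bs

lastFrom : Bool → List Bool → Bool
lastFrom p []       = p
lastFrom p (b ∷ bs) = lastFrom b bs

lastB-∷ : ∀ b S → lastB (b ∷ S) ≡ lastFrom b S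
lastB-∷ b []      = refl
lastB-∷ b (c ∷ S) = lastB-∷ c S

-- Every element of S either starts a run or is adjacent to its predecessor.
size≡runs+adjacencies : ∀ p S → size S ≡ runsAux p S ℕ.+ adjacencies p S
size≡runs+adjacencies p     []          = refl
size≡runs+adjacencies p     (false ∷ S) = size≡runs+adjacencies false S
size≡runs+adjacencies false (true ∷ S)  = cong suc (size≡runs+adjacencies true S)
size≡runs+adjacencies true  (true ∷ S)  =
  trans (cong suc (size≡runs+adjacencies true S)) (sym (ℕₚ.+-suc (runsAux true S) (adjacencies true S)))

size∸runs≡adjacencies : ∀ p S → size S ∸ runsAux p S ≡ adjacencies p S
size∸runs≡adjacencies p S =
  trans (cong (_∸ runsAux p S) (size≡runs+adjacencies p S)) (ℕₚ.m+n∸m≡n (runsAux p S) (adjacencies p S))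

-- Since 0 ^ a is the indicator of a = 0, this weight selects the sets with no two
-- consecutive elements; `ε` weighs whether the last position is occupied.
indepWeight : (Bool → ℤ) → Bool → List Bool → ℤ
indepWeight ε p S = 0ℤ ^ adjacencies p S * ε (lastFrom p S)

unconstrained lastOccupied : Bool → ℤ
unconstrained _ = 1ℤ
lastOccupied b  = if b then 1ℤ else 0ℤ

-- Position i is either empty, or occupied (contributing s^i) when its predecessor is empty.
indepSeries : (Bool → ℤ) → Bool → ℕ → ℕ → PS
indepSeries ε p     i zero    d = if 0 ≡ᵇ d then ε p else 0ℤ
indepSeries ε false i (suc n) d = indepSeries ε false (suc i) n d + shift i (indepSeries ε true (suc i) n) d
indepSeries ε true  i (suc n) d = indepSeries ε false (suc i) n d

subsetSeries-indepWeight : ∀ ε p i n d → subsetSeries i n (indepWeight ε p) d ≡ indepSeries ε p i n d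
subsetSeries-indepWeight ε p     i zero    d =
  trans (subsetSeries-empty i (indepWeight ε p) d) (cong (if 0 ≡ᵇ d then_else 0ℤ) (ℤₚ.*-identityˡ (ε p)))
subsetSeries-indepWeight ε false i (suc n) d =
  trans (subsetSeries-suc i n (indepWeight ε false) d)
        (cong₂ _+_ (subsetSeries-indepWeight ε false (suc i) n d)
                   (shift-cong i (subsetSeries-indepWeight ε true (suc i) n) d))
subsetSeries-indepWeight ε true  i (suc n) d =
  trans (subsetSeries-suc i n (indepWeight ε true) d)
        (trans (cong₂ _+_ (subsetSeries-indepWeight ε false (suc i) n d)
                          (shift-vanish i (subsetSeries-vanish (suc i) n adjacent) d))
               (ℤₚ.+-identityʳ _))
  where
  adjacent : ∀ S → indepWeight ε true (true ∷ S) ≡ 0ℤ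
  adjacent S = trans (cong (_* ε (lastFrom true S)) (0^suc≡0 (adjacencies true S)))
                     (ℤₚ.*-zeroˡ (ε (lastFrom true S)))

segWeight-1-1 : ∀ S → segWeight 1ℤ 1ℤ S ≡ indepWeight unconstrained false S
segWeight-1-1 S = begin
  1ℤ ^ size S * (1ℤ ^ runs S * 0ℤ ^ (size S ∸ runs S))
    ≡⟨ cong₂ (λ x y → x * (y * 0ℤ ^ (size S ∸ runs S))) (ℤₚ.^-zeroˡ (size S)) (ℤₚ.^-zeroˡ (runs S)) ⟩
  1ℤ * (1ℤ * 0ℤ ^ (size S ∸ runs S))
    ≡⟨ trans (ℤₚ.*-identityˡ _) (ℤₚ.*-identityˡ _) ⟩
  0ℤ ^ (size S ∸ runs S)
    ≡⟨ cong (0ℤ ^_) (size∸runs≡adjacencies false S) ⟩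
  0ℤ ^ adjacencies false S
    ≡⟨ ℤₚ.*-identityʳ _ ⟨
  indepWeight unconstrained false S ∎

-- The full circle also gets weight 0, since (1 - 1)^n + (-1)^n (1 - 1) = 0 for n ≥ 1.
Pcyc-1-1 : ∀ n b S →
  1ℤ ^ size (b ∷ S) * Pcyc (suc n) 1ℤ (b ∷ S) ≡ 0ℤ ^ adjacencies (lastB (b ∷ S)) (b ∷ S)
Pcyc-1-1 n b S =
  trans (cong (_* Pcyc (suc n) 1ℤ (b ∷ S)) (ℤₚ.^-zeroˡ (size (b ∷ S))))
        (trans (ℤₚ.*-identityˡ _) (byFullness b (isFull S) refl))
  where
  notFull : ∀ b → 1ℤ ^ cycRuns (b ∷ S) * 0ℤ ^ (size (b ∷ S) ∸ cycRuns (b ∷ S))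
                  ≡ 0ℤ ^ adjacencies (lastB (b ∷ S)) (b ∷ S)
  notFull b = trans (cong (_* 0ℤ ^ (size (b ∷ S) ∸ cycRuns (b ∷ S))) (ℤₚ.^-zeroˡ (cycRuns (b ∷ S))))
    (trans (ℤₚ.*-identityˡ _) (cong (0ℤ ^_) (size∸runs≡adjacencies (lastB (b ∷ S)) (b ∷ S))))
  lastFrom-full : ∀ S → isFull S ≡ true → lastFrom true S ≡ true
  lastFrom-full []         _    = refl
  lastFrom-full (true ∷ S) full = lastFrom-full S full
  byFullness : ∀ b f → isFull S ≡ f → Pcyc (suc n) 1ℤ (b ∷ S) ≡ 0ℤ ^ adjacencies (lastB (b ∷ S)) (b ∷ S)
  byFullness false _     _    = notFull false
  byFullness true  false full rewrite full = notFull true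
  byFullness true  true  full rewrite full | lastB-∷ true S | lastFrom-full S full =
    trans (cong₂ _+_ (0^suc≡0 n) (ℤₚ.*-zeroʳ ((- 1ℤ) ^ suc n))) (sym (0^suc≡0 (adjacencies true S)))

-- A set is counted on the segment but not on the circle exactly when it contains both
-- endpoints; then 1 is occupied, 2 is not, and the rest is a segment set ending in n.
segment-circle-∷ : ∀ b S →
  indepWeight unconstrained false (b ∷ S) - 0ℤ ^ adjacencies (lastB (b ∷ S)) (b ∷ S)
  ≡ (if b then indepWeight lastOccupied true S else 0ℤ)
segment-circle-∷ false S = trans (cong (_- x) (ℤₚ.*-identityʳ x)) (ℤₚ.+-inverseʳ x)
  where x = 0ℤ ^ adjacencies false S
segment-circle-∷ true  S =
  trans (byLast (lastB (true ∷ S))) (cong (λ q → x * lastOccupied q) (lastB-∷ true S))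
  where
  x = 0ℤ ^ adjacencies true S
  byLast : ∀ q → x * 1ℤ - 0ℤ ^ ((if q then 1 else 0) ℕ.+ adjacencies true S) ≡ x * lastOccupied q
  byLast true  = trans (cong (λ y → x * 1ℤ - y) (0^suc≡0 (adjacencies true S))) (ℤₚ.+-identityʳ _)
  byLast false = trans (cong (_- x) (ℤₚ.*-identityʳ x)) (trans (ℤₚ.+-inverseʳ x) (sym (ℤₚ.*-zeroʳ x)))

-- If the last position i + n + 1 is occupied then i + n is empty, and what remains is
-- any independent subset of {i, …, i + n - 1}.
indepSeries-lastOccupied : ∀ p i n d →
  indepSeries lastOccupied p i (suc (suc n)) d ≡ shift (suc (i ℕ.+ n)) (indepSeries unconstrained p i n) d
indepSeries-lastOccupied true  i zero    d = begin
  (if 0 ≡ᵇ d then 0ℤ else 0ℤ) + shift (suc i) (mono 0) d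
    ≡⟨ trans (cong (_+ shift (suc i) (mono 0) d) (if-eta (0 ≡ᵇ d))) (ℤₚ.+-identityˡ _) ⟩
  shift (suc i) (mono 0) d
    ≡⟨ cong (λ e → shift (suc e) (mono 0) d) (ℕₚ.+-identityʳ i) ⟨
  shift (suc (i ℕ.+ 0)) (mono 0) d ∎
indepSeries-lastOccupied false i zero    d =
  trans (cong₂ _+_ (indepSeries-lastOccupied true i zero d) (shift-vanish i (λ x → if-eta (0 ≡ᵇ x)) d))
        (ℤₚ.+-identityʳ _)
indepSeries-lastOccupied true  i (suc n) d =
  trans (indepSeries-lastOccupied false (suc i) n d)
        (cong (λ e → shift (suc e) (indepSeries unconstrained false (suc i) n) d) (sym (ℕₚ.+-suc i n)))
indepSeries-lastOccupied false i (suc n) d = begin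
  indepSeries lastOccupied false (suc i) (suc (suc n)) d
    + shift i (indepSeries lastOccupied true (suc i) (suc (suc n))) d
    ≡⟨ cong₂ _+_ (indepSeries-lastOccupied false (suc i) n d)
                 (shift-cong i (indepSeries-lastOccupied true (suc i) n) d) ⟩
  shift L F d + shift i (shift L T) d
    ≡⟨ cong (shift L F d +_) (shift-comm i L T d) ⟩
  shift L F d + shift L (shift i T) d
    ≡⟨ shift-distrib-+ L F (shift i T) d ⟨
  shift L (indepSeries unconstrained false i (suc n)) d
    ≡⟨ cong (λ e → shift (suc e) (indepSeries unconstrained false i (suc n)) d) (ℕₚ.+-suc i n) ⟨
  shift (suc (i ℕ.+ suc n)) (indepSeries unconstrained false i (suc n)) d ∎
  where
  L = suc (suc i ℕ.+ n)
  F = indepSeries unconstrained false (suc i) n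
  T = indepSeries unconstrained true (suc i) n

-- Both sides obey the functional equation of rrFamily-rec; truncating the segment at
-- j + n only affects coefficients of order > j + n.
indepSeries≡rrFamily : ∀ n j d → d ≤ j ℕ.+ n → indepSeries unconstrained false (suc j) n d ≡ rrFamily j d
indepSeries≡rrFamily zero    j d d≤j+0 =
  sym (rrFamily-small j d (subst (d ≤_) (ℕₚ.+-identityʳ j) d≤j+0))
indepSeries≡rrFamily (suc n) j d d≤j+1+n = begin
  indepSeries unconstrained false (2 ℕ.+ j) n d + shift (suc j) (indepSeries unconstrained true (2 ℕ.+ j) n) d
    ≡⟨ cong₂ _+_ (indepSeries≡rrFamily n (suc j) d d≤1+j+n)
                 (cong (if suc j ≤ᵇ d then_else 0ℤ) (afterOccupied n (ℕₚ.m≤n+o⇒m∸n≤o d (suc j) d≤1+j+n))) ⟩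
  rrFamily (suc j) d + shift (suc j) (rrFamily (2 ℕ.+ j)) d
    ≡⟨ rrFamily-rec j d ⟨
  rrFamily j d ∎
  where
  d≤1+j+n = subst (d ≤_) (ℕₚ.+-suc j n) d≤j+1+n
  x = d ∸ suc j
  afterOccupied : ∀ n → x ≤ n → indepSeries unconstrained true (2 ℕ.+ j) n x ≡ rrFamily (2 ℕ.+ j) x
  afterOccupied zero    x≤0   = indepSeries≡rrFamily zero (2 ℕ.+ j) x (ℕₚ.≤-trans x≤0 z≤n)
  afterOccupied (suc n) x≤1+n =
    indepSeries≡rrFamily n (2 ℕ.+ j) x (ℕₚ.≤-trans x≤1+n (s≤s (ℕₚ.m≤n+m n (suc j))))

Gseg≡indepSeries : ∀ n d → Gseg 1ℤ 1ℤ n d ≡ indepSeries unconstrained false 1 n d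
Gseg≡indepSeries n d =
  trans (subsetSeries-cong 1 n segWeight-1-1 d) (subsetSeries-indepWeight unconstrained false 1 n d)

Gseg-Gcyc : ∀ m d →
  Gseg 1ℤ 1ℤ (3 ℕ.+ m) d - Gcyc 1ℤ 1ℤ (3 ℕ.+ m) d ≡ shift (4 ℕ.+ m) (indepSeries unconstrained true 2 m) d
Gseg-Gcyc m d = begin
  Gseg 1ℤ 1ℤ (3 ℕ.+ m) d - Gcyc 1ℤ 1ℤ (3 ℕ.+ m) d
    ≡⟨ cong₂ _-_ (subsetSeries-cong 1 (3 ℕ.+ m) segWeight-1-1 d)
                 (subsetSeries-cong-∷ 1 (2 ℕ.+ m) (Pcyc-1-1 (2 ℕ.+ m)) d) ⟩
  subsetSeries 1 (3 ℕ.+ m) segment d - subsetSeries 1 (3 ℕ.+ m) circle d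
    ≡⟨ subsetSeries-− 1 (3 ℕ.+ m) segment circle d ⟩
  subsetSeries 1 (3 ℕ.+ m) (λ S → segment S - circle S) d
    ≡⟨ subsetSeries-suc 1 (2 ℕ.+ m) _ d ⟩
  subsetSeries 2 (2 ℕ.+ m) (λ S → segment (false ∷ S) - circle (false ∷ S)) d
    + shift 1 (subsetSeries 2 (2 ℕ.+ m) (λ S → segment (true ∷ S) - circle (true ∷ S))) d
    ≡⟨ cong₂ _+_ (subsetSeries-vanish 2 (2 ℕ.+ m) (segment-circle-∷ false) d)
                 (shift-cong 1 (subsetSeries-cong 2 (2 ℕ.+ m) (segment-circle-∷ true)) d) ⟩
  0ℤ + shift 1 (subsetSeries 2 (2 ℕ.+ m) (indepWeight lastOccupied true)) d
    ≡⟨ ℤₚ.+-identityˡ _ ⟩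
  shift 1 (subsetSeries 2 (2 ℕ.+ m) (indepWeight lastOccupied true)) d
    ≡⟨ shift-cong 1 (subsetSeries-indepWeight lastOccupied true 2 (2 ℕ.+ m)) d ⟩
  shift 1 (indepSeries lastOccupied true 2 (2 ℕ.+ m)) d
    ≡⟨ shift-cong 1 (indepSeries-lastOccupied true 2 m) d ⟩
  shift 1 (shift (3 ℕ.+ m) (indepSeries unconstrained true 2 m)) d
    ≡⟨ shift-shift 1 (3 ℕ.+ m) (indepSeries unconstrained true 2 m) d ⟩
  shift (4 ℕ.+ m) (indepSeries unconstrained true 2 m) d ∎
  where
  segment circle : List Bool → ℤ
  segment = indepWeight unconstrained false
  circle S = 0ℤ ^ adjacencies (lastB S) S

seriesA≡rrFamily : ∀ d → seriesA d ≡ rrFamily 0 d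
seriesA≡rrFamily = rrSeries-cong (λ k → cong (k ℕ.*_) (sym (ℕₚ.+-identityʳ k)))

seriesB≡rrFamily : ∀ d → seriesB d ≡ rrFamily 1 d
seriesB≡rrFamily = rrSeries-cong (λ k → cong (k ℕ.*_) (ℕₚ.+-comm 1 k))

seriesC≡rrFamily : ∀ d → seriesC d ≡ rrFamily 2 d
seriesC≡rrFamily = rrSeries-cong (λ k → cong (k ℕ.*_) (ℕₚ.+-comm 2 k))

seriesA-seriesB : ∀ d → seriesA (suc d) - seriesB (suc d) ≡ seriesC d
seriesA-seriesB d = begin
  seriesA (suc d) - seriesB (suc d)
    ≡⟨ cong₂ _-_ (seriesA≡rrFamily (suc d)) (seriesB≡rrFamily (suc d)) ⟩
  rrFamily 0 (suc d) - rrFamily 1 (suc d)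
    ≡⟨ cong (_- rrFamily 1 (suc d)) (rrFamily-rec 0 (suc d)) ⟩
  rrFamily 1 (suc d) + rrFamily 2 d - rrFamily 1 (suc d)
    ≡⟨ xyx⁻¹≈y (rrFamily 1 (suc d)) (rrFamily 2 d) ⟩
  rrFamily 2 d
    ≡⟨ seriesC≡rrFamily d ⟨
  seriesC d ∎

ConvergesTo-cong : ∀ {f : ℕ → PS} {g h : PS} → (∀ d → g d ≡ h d) → ConvergesTo f g → ConvergesTo f h
ConvergesTo-cong g≗h f⟶g d = let N , conv = f⟶g d in N , λ n N≤n → trans (conv n N≤n) (g≗h d)

Gseg⟶seriesA : ConvergesTo (λ n → Gseg 1ℤ 1ℤ n) seriesA
Gseg⟶seriesA d = d , λ n d≤n →
  trans (Gseg≡indepSeries n d) (trans (indepSeries≡rrFamily n 0 d d≤n) (sym (seriesA≡rrFamily d)))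

Gseg-Gcyc-low : ∀ n d → d < suc n → Gseg 1ℤ 1ℤ n d - Gcyc 1ℤ 1ℤ n d ≡ 0ℤ
Gseg-Gcyc-low 0 d _ = ℤₚ.+-inverseʳ (Gseg 1ℤ 1ℤ 0 d)
Gseg-Gcyc-low 1 d _ = ℤₚ.+-inverseʳ (Gseg 1ℤ 1ℤ 1 d)
Gseg-Gcyc-low 2 d _ = ℤₚ.+-inverseʳ (Gseg 1ℤ 1ℤ 2 d)
Gseg-Gcyc-low (suc (suc (suc m))) d d<4+m =
  trans (Gseg-Gcyc m d) (shift-below (indepSeries unconstrained true 2 m) d<4+m)

diffQuot⟶seriesC : ConvergesTo diffQuot seriesC
diffQuot⟶seriesC d = 4 ℕ.+ d , λ { (suc (suc (suc (suc m)))) (s≤s (s≤s (s≤s (s≤s d≤m)))) → begin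
  diffQuot (4 ℕ.+ m) d
    ≡⟨ Gseg-Gcyc (suc m) (d ℕ.+ (5 ℕ.+ m)) ⟩
  shift (5 ℕ.+ m) (indepSeries unconstrained true 2 (suc m)) (d ℕ.+ (5 ℕ.+ m))
    ≡⟨ shift-apply (5 ℕ.+ m) (indepSeries unconstrained true 2 (suc m)) d ⟩
  indepSeries unconstrained false 3 m d
    ≡⟨ indepSeries≡rrFamily m 2 d (ℕₚ.≤-trans d≤m (ℕₚ.m≤n+m m 2)) ⟩
  rrFamily 2 d
    ≡⟨ seriesC≡rrFamily d ⟨
  seriesC d ∎ }

mainTheorem7 :
    ConvergesTo (λ n → Gseg 1ℤ 1ℤ n) seriesA
    × (∀ n d → d < suc n → Gseg 1ℤ 1ℤ n d - Gcyc 1ℤ 1ℤ n d ≡ 0ℤ)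
    × ConvergesTo diffQuot (λ d → seriesA (suc d) - seriesB (suc d))
    × (seriesA 0 - seriesB 0 ≡ 0ℤ)
    × (∀ d → seriesA (suc d) - seriesB (suc d) ≡ seriesC d)
mainTheorem7 =
    Gseg⟶seriesA
  , Gseg-Gcyc-low
  , ConvergesTo-cong (λ d → sym (seriesA-seriesB d)) diffQuot⟶seriesC
  , refl
  , seriesA-seriesB
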